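{- The ratio $\frac{D(G\star K_1)}{D(G)}$ can be arbitrarily small over connected graphs $G$ of order greater than $1$: for every $\varepsilon>0$ there exists a connected graph $G$ of order $n>1$ with $\frac{D(G\star K_1)}{D(G)}<\varepsilon$.
   Context: All graphs are finite and simple. The distinguishing number $D(G)$ is the least $r$ such that there is a labeling $V(G)\to\{1,\dots,r\}$ preserved by no non-identity automorphism of $G$. For a graph $G$, $G\star K_1$ is the graph obtained from $G$ by adding, for each vertex $v$ of $G$, a new vertex $K_1^{v}$ adjacent exactly to the neighbours of $v$ in $G$ (the neighbourhood corona of $G$ with $K_1$).
   Formalization: The threshold ε ranges only over the positive rationals. -}

module Defs where

open import Data.Nat using (ℕ; _+_; _<_)
open import Data.Bool using (Bool; true; false)
open import Data.Fin using (Fin; splitAt)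
open import Data.Fin.Permutation using (Permutation′; _⟨$⟩ʳ_)
open import Data.Sum using (_⊎_; inj₁; inj₂)
open import Data.Product using (Σ; ∃; _×_)
open import Relation.Nullary using (¬_)
open import Relation.Binary.PropositionalEquality using (_≡_)
open import Relation.Binary.Construct.Closure.ReflexiveTransitive using (Star)

record Graph (n : ℕ) : Set where
  field
    adj    : Fin n → Fin n → Bool
    sym    : ∀ u v → adj u v ≡ adj v u
    irrefl : ∀ v → adj v v ≡ false
open Graph public

Connected : ∀ {n} → Graph n → Set
Connected G = ∀ u v → Star (λ a b → adj G a b ≡ true) u v

IsAutomorphism : ∀ {n} → Graph n → Permutation′ n → Set
IsAutomorphism G σ = ∀ u v → adj G (σ ⟨$⟩ʳ u) (σ ⟨$⟩ʳ v) ≡ adj G u v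

IsDistinguishing : ∀ {n} (G : Graph n) {r : ℕ} → (Fin n → Fin r) → Set
IsDistinguishing {n} G c =
  (σ : Permutation′ n) → IsAutomorphism G σ →
  (∀ v → c (σ ⟨$⟩ʳ v) ≡ c v) → ∀ v → σ ⟨$⟩ʳ v ≡ v

HasDistLabeling : ∀ {n} → Graph n → ℕ → Set
HasDistLabeling {n} G r = Σ (Fin n → Fin r) (IsDistinguishing G)

IsDistNumber : ∀ {n} → Graph n → ℕ → Set
IsDistNumber G d = HasDistLabeling G d × (∀ r → r < d → ¬ HasDistLabeling G r)

-- Neighbourhood corona G ⋆ K₁ on Fin (n + n): the first copy is G, vertex
-- inj₂ v (via splitAt) is K₁^v, adjacent exactly to the neighbours of v in G.
coronaAdj : ∀ {n} → Graph n → Fin n ⊎ Fin n → Fin n ⊎ Fin n → Bool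
coronaAdj G (inj₁ u) (inj₁ v) = adj G u v
coronaAdj G (inj₁ u) (inj₂ v) = adj G u v
coronaAdj G (inj₂ u) (inj₁ v) = adj G u v
coronaAdj G (inj₂ u) (inj₂ v) = false

coronaSym : ∀ {n} (G : Graph n) x y → coronaAdj G x y ≡ coronaAdj G y x
coronaSym G (inj₁ u) (inj₁ v) = sym G u v
coronaSym G (inj₁ u) (inj₂ v) = sym G u v
coronaSym G (inj₂ u) (inj₁ v) = sym G u v
coronaSym G (inj₂ u) (inj₂ v) = Relation.Binary.PropositionalEquality.refl

coronaIrrefl : ∀ {n} (G : Graph n) x → coronaAdj G x x ≡ false
coronaIrrefl G (inj₁ u) = irrefl G u
coronaIrrefl G (inj₂ u) = Relation.Binary.PropositionalEquality.refl

corona : ∀ {n} → Graph n → Graph (n + n)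
corona {n} G = record
  { adj    = λ x y → coronaAdj G (splitAt n x) (splitAt n y)
  ; sym    = λ x y → coronaSym G (splitAt n x) (splitAt n y)
  ; irrefl = λ x → coronaIrrefl G (splitAt n x)
  }

-- In the complete graph K_n every permutation is an automorphism, so D(K_n) = n.
-- In K_n ⋆ K₁ (n ≥ 2) the vertex K₁^v is the only non-neighbour of v, whereas K₁^v
-- has at least two; hence every automorphism maps each pair (v, K₁^v) onto a pair
-- (w, K₁^w), layer by layer. A labeling is therefore distinguishing as soon as the
-- label pairs (c v, c K₁^v) are all different, and it can only be distinguishing if
-- they are, since otherwise the transposition of two such v lifts to an automorphism
-- preserving c. So D(K_{k²} ⋆ K₁) = k while D(K_{k²}) = k², a ratio of 1/k.
module Submission where

open import Data.Bool using (Bool; true; false; not)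
open import Data.Empty using (⊥-elim)
open import Data.Fin using (Fin; zero; splitAt; join; combine; punchIn)
open import Data.Fin.Properties
  using (_≟_; pigeonhole; <⇒≢; +↔⊎; *↔×; splitAt-join; join-splitAt; ↑ˡ-injective; combine-injective; punchInᵢ≢i)
open import Data.Fin.Permutation using (Permutation′; _⟨$⟩ʳ_; transpose)
import Data.Fin.Permutation.Components as PC
open import Data.Nat using (ℕ; suc; _+_; _*_; _<_; z≤n; s≤s)
open import Data.Nat.Properties using (*-mono-<; *-monoʳ-<; <-≤-trans; m≤n*m; n<1+n)
open import Data.Product using (Σ; ∃; _×_; _,_; proj₁; proj₂)
open import Data.Sum using (_⊎_; inj₁; inj₂; [_,_])
open import Data.Sum.Properties using (inj₂-injective)
open import Data.Sum.Function.Propositional using (_⊎-↔_)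
open import Function using (_∘_)
open import Function.Bundles using (_↔_; _↣_; Inverse; Injection)
open import Function.Construct.Composition using (_↔-∘_)
open import Function.Construct.Symmetry using (↔-sym)
open import Function.Properties.Inverse using (↔⇒↣)
open import Relation.Nullary using (¬_; yes; no; does)
open import Relation.Binary.PropositionalEquality
  using (_≡_; _≢_; refl; sym; trans; cong; cong₂; module ≡-Reasoning)
open import Relation.Binary.Construct.Closure.ReflexiveTransitive using (ε; _◅_)

open import Defs hiding (sym)

Preserves : {A B : Set} → (A → A → B) → (A → A) → Set
Preserves R f = ∀ a b → R (f a) (f b) ≡ R a b

inverse-preserves : {A B : Set} (R : A → A → B) (s : A ↔ A) →
  Preserves R (Inverse.to s) → Preserves R (Inverse.from s)
inverse-preserves R s pres a b = begin
  R (from a) (from b)           ≡⟨ pres (from a) (from b) ⟨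
  R (to (from a)) (to (from b)) ≡⟨ cong₂ R (strictlyInverseˡ a) (strictlyInverseˡ b) ⟩
  R a b                         ∎
  where open Inverse s; open ≡-Reasoning

moved⇒¬distinguishing : ∀ {n r} (G : Graph n) {c : Fin n → Fin r} (σ : Permutation′ n) →
  IsAutomorphism G σ → (∀ v → c (σ ⟨$⟩ʳ v) ≡ c v) →
  ∀ v → σ ⟨$⟩ʳ v ≢ v → ¬ IsDistinguishing G c
moved⇒¬distinguishing G σ aut pres v moved dist = moved (dist σ aut pres v)

transpose-moves : ∀ {n} {i j : Fin n} → i ≢ j → PC.transpose i j i ≢ i
transpose-moves {i = i} i≢j with i ≟ i
... | yes _  = i≢j ∘ sym
... | no i≢i = ⊥-elim (i≢i refl)

transpose-preserves : ∀ {n} {A : Set} (f : Fin n → A) {i j} → f i ≡ f j →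
  ∀ v → f (PC.transpose i j v) ≡ f v
transpose-preserves f {i} {j} fᵢ≡fⱼ v with v ≟ i
... | yes refl = sym fᵢ≡fⱼ
... | no _ with v ≟ j
...   | yes refl = fᵢ≡fⱼ
...   | no _     = refl

module _ {n : ℕ} where

  distinct : Fin n → Fin n → Bool
  distinct u v = not (does (u ≟ v))

  distinct-sym : ∀ u v → distinct u v ≡ distinct v u
  distinct-sym u v with u ≟ v | v ≟ u
  ... | yes _   | yes _   = refl
  ... | no _    | no _    = refl
  ... | yes u≡v | no v≢u  = ⊥-elim (v≢u (sym u≡v))
  ... | no u≢v  | yes v≡u = ⊥-elim (u≢v (sym v≡u))

  distinct-irrefl : ∀ v → distinct v v ≡ false
  distinct-irrefl v with v ≟ v
  ... | yes _  = refl
  ... | no v≢v = ⊥-elim (v≢v refl)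

  ¬distinct⇒≡ : ∀ {u v} → distinct u v ≡ false → u ≡ v
  ¬distinct⇒≡ {u} {v} _ with u ≟ v
  ... | yes u≡v = u≡v
  ¬distinct⇒≡ () | no _

  ≢⇒distinct : ∀ {u v} → u ≢ v → distinct u v ≡ true
  ≢⇒distinct {u} {v} u≢v with u ≟ v
  ... | yes u≡v = ⊥-elim (u≢v u≡v)
  ... | no _    = refl

  permutation-preserves-distinct : (π : Permutation′ n) → Preserves distinct (π ⟨$⟩ʳ_)
  permutation-preserves-distinct π u v with u ≟ v | π ⟨$⟩ʳ u ≟ π ⟨$⟩ʳ v
  ... | yes _   | yes _     = refl
  ... | no _    | no _      = refl
  ... | yes u≡v | no πu≢πv  = ⊥-elim (πu≢πv (cong (π ⟨$⟩ʳ_) u≡v))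
  ... | no u≢v  | yes πu≡πv = ⊥-elim (u≢v (Injection.injective (↔⇒↣ π) πu≡πv))

complete : ∀ n → Graph n
complete n = record { adj = distinct ; sym = distinct-sym ; irrefl = distinct-irrefl }

complete-connected : ∀ n → Connected (complete n)
complete-connected n u v with u ≟ v
... | yes refl = ε
... | no u≢v   = ≢⇒distinct u≢v ◅ ε

complete-automorphism : ∀ {n} (π : Permutation′ n) → IsAutomorphism (complete n) π
complete-automorphism = permutation-preserves-distinct

complete-¬distinguishing : ∀ {n r} → r < n → ¬ HasDistLabeling (complete n) r
complete-¬distinguishing {n} r<n (c , dist) with pigeonhole r<n c
... | i , j , i<j , cᵢ≡cⱼ =
  moved⇒¬distinguishing (complete n) (transpose i j) (complete-automorphism (transpose i j))
    (transpose-preserves c cᵢ≡cⱼ) i (transpose-moves (<⇒≢ i<j)) dist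

complete-distNumber : ∀ n → IsDistNumber (complete n) n
complete-distNumber n = ((λ v → v) , λ σ _ pres → pres) , λ _ → complete-¬distinguishing

module _ {n : ℕ} where

  sumView : Permutation′ (n + n) → (Fin n ⊎ Fin n) ↔ (Fin n ⊎ Fin n)
  sumView σ = +↔⊎ ↔-∘ (σ ↔-∘ ↔-sym +↔⊎)

  fromSumView : (Fin n ⊎ Fin n) ↔ (Fin n ⊎ Fin n) → Permutation′ (n + n)
  fromSumView s = ↔-sym +↔⊎ ↔-∘ (s ↔-∘ +↔⊎)

  sumView-automorphism : (G : Graph n) (σ : Permutation′ (n + n)) →
    IsAutomorphism (corona G) σ → Preserves (coronaAdj G) (Inverse.to (sumView σ))
  sumView-automorphism G σ aut a b with aut (join n n a) (join n n b)
  ... | e rewrite splitAt-join n n a | splitAt-join n n b = e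

  fromSumView-automorphism : (G : Graph n) (s : (Fin n ⊎ Fin n) ↔ (Fin n ⊎ Fin n)) →
    Preserves (coronaAdj G) (Inverse.to s) → IsAutomorphism (corona G) (fromSumView s)
  fromSumView-automorphism G s pres x y
    rewrite splitAt-join n n (Inverse.to s (splitAt n x))
          | splitAt-join n n (Inverse.to s (splitAt n y)) = pres (splitAt n x) (splitAt n y)

  sumView-fixes⇒fixes : (σ : Permutation′ (n + n)) →
    (∀ a → Inverse.to (sumView σ) a ≡ a) → ∀ x → σ ⟨$⟩ʳ x ≡ x
  sumView-fixes⇒fixes σ fixes x = begin
    σ ⟨$⟩ʳ x                               ≡⟨ join-splitAt n n _ ⟨
    join n n (splitAt n (σ ⟨$⟩ʳ x))         ≡⟨ cong (join n n ∘ splitAt n ∘ (σ ⟨$⟩ʳ_)) (join-splitAt n n x) ⟨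
    join n n (Inverse.to (sumView σ) (splitAt n x)) ≡⟨ cong (join n n) (fixes (splitAt n x)) ⟩
    join n n (splitAt n x)                  ≡⟨ join-splitAt n n x ⟩
    x                                       ∎
    where open ≡-Reasoning

  coronaLift : Permutation′ n → Permutation′ (n + n)
  coronaLift π = fromSumView (π ⊎-↔ π)

  coronaLift-automorphism : (G : Graph n) (π : Permutation′ n) →
    IsAutomorphism G π → IsAutomorphism (corona G) (coronaLift π)
  coronaLift-automorphism G π aut = fromSumView-automorphism G (π ⊎-↔ π) pres
    where
    pres : Preserves (coronaAdj G) (Inverse.to (π ⊎-↔ π))
    pres (inj₁ u) (inj₁ v) = aut u v
    pres (inj₁ u) (inj₂ v) = aut u v
    pres (inj₂ u) (inj₁ v) = aut u v
    pres (inj₂ u) (inj₂ v) = refl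

  coronaLift-inj₁ : (π : Permutation′ n) (u : Fin n) →
    coronaLift π ⟨$⟩ʳ join n n (inj₁ u) ≡ join n n (inj₁ (π ⟨$⟩ʳ u))
  coronaLift-inj₁ π u = cong (join n n ∘ Inverse.to (π ⊎-↔ π)) (splitAt-join n n (inj₁ u))

layerPair : ∀ {n r} → (Fin (n + n) → Fin r) → Fin n → Fin (r * r)
layerPair {n} c u = combine (c (join n n (inj₁ u))) (c (join n n (inj₂ u)))

corona-complete-¬distinguishing : ∀ {n r} → r * r < n → ¬ HasDistLabeling (corona (complete n)) r
corona-complete-¬distinguishing {n} r²<n (c , dist) with pigeonhole r²<n (layerPair c)
... | i , j , i<j , same with combine-injective _ _ _ _ same
... | same₁ , same₂ =
  moved⇒¬distinguishing (corona (complete n)) τ (coronaLift-automorphism (complete n) (transpose i j) (complete-automorphism (transpose i j))) pres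
    (join n n (inj₁ i)) moved dist
  where
  τ = coronaLift (transpose i j)

  pres⊎ : ∀ a → c (join n n (Inverse.to (transpose i j ⊎-↔ transpose i j) a)) ≡ c (join n n a)
  pres⊎ (inj₁ v) = transpose-preserves (c ∘ join n n ∘ inj₁) same₁ v
  pres⊎ (inj₂ v) = transpose-preserves (c ∘ join n n ∘ inj₂) same₂ v

  pres : ∀ x → c (τ ⟨$⟩ʳ x) ≡ c x
  pres x = trans (pres⊎ (splitAt n x)) (cong c (join-splitAt n n x))

  moved : τ ⟨$⟩ʳ join n n (inj₁ i) ≢ join n n (inj₁ i)
  moved e = transpose-moves (<⇒≢ i<j) (↑ˡ-injective n _ _ (trans (sym (coronaLift-inj₁ (transpose i j) i)) e))

complete-corona-nonadjacent : ∀ {n} (w : Fin n) y →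
  coronaAdj (complete n) (inj₁ w) y ≡ false → y ≡ inj₁ w ⊎ y ≡ inj₂ w
complete-corona-nonadjacent w (inj₁ v) e = inj₁ (cong inj₁ (sym (¬distinct⇒≡ e)))
complete-corona-nonadjacent w (inj₂ v) e = inj₂ (cong inj₂ (sym (¬distinct⇒≡ e)))

module _ {m : ℕ} where

  private
    G = complete (2 + m)
    V = Fin (2 + m) ⊎ Fin (2 + m)

  corona-complete-layer₂ : (s : V ↔ V) → Preserves (coronaAdj G) (Inverse.to s) →
    ∀ u → ∃ λ w → Inverse.to s (inj₂ u) ≡ inj₂ w
  corona-complete-layer₂ s pres u with Inverse.to s (inj₂ u) in eq
  ... | inj₂ w = w , refl
  ... | inj₁ w with injective (trans (image-is-twin (inj₁ u) (λ ()) (distinct-irrefl u))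
                                     (sym (image-is-twin (inj₂ v) v≢u refl)))
    where
    open Injection (↔⇒↣ s) using (injective)

    -- inj₂ u has the two distinct non-neighbours inj₁ u and inj₂ v, but inj₁ w has only inj₂ w.
    v = punchIn u zero

    v≢u : inj₂ v ≢ inj₂ u
    v≢u = punchInᵢ≢i u zero ∘ inj₂-injective

    image-is-twin : ∀ x → x ≢ inj₂ u → coronaAdj G (inj₂ u) x ≡ false → Inverse.to s x ≡ inj₂ w
    image-is-twin x x≢ nonadj
      with complete-corona-nonadjacent w (Inverse.to s x)
             (trans (cong (λ z → coronaAdj G z (Inverse.to s x)) (sym eq)) (trans (pres (inj₂ u) x) nonadj))
    ... | inj₁ e = ⊥-elim (x≢ (injective (trans e (sym eq))))
    ... | inj₂ e = e
  ... | ()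

  corona-complete-layer₁ : (s : V ↔ V) → Preserves (coronaAdj G) (Inverse.to s) →
    ∀ u → ∃ λ w → Inverse.to s (inj₁ u) ≡ inj₁ w
  corona-complete-layer₁ s pres u with Inverse.to s (inj₁ u) in eq
  ... | inj₁ w = w , refl
  ... | inj₂ w with corona-complete-layer₂ (↔-sym s) (inverse-preserves _ s pres) w
  ...   | w′ , e with trans (sym (Inverse.strictlyInverseʳ s (inj₁ u))) (trans (cong (Inverse.from s) eq) e)
  ...     | ()

  corona-complete-pairs : (s : V ↔ V) → Preserves (coronaAdj G) (Inverse.to s) →
    ∀ u → ∃ λ a → Inverse.to s (inj₁ u) ≡ inj₁ a × Inverse.to s (inj₂ u) ≡ inj₂ a
  corona-complete-pairs s pres u with corona-complete-layer₁ s pres u | corona-complete-layer₂ s pres u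
  ... | a , e₁ | b , e₂ = a , e₁ , trans e₂ (cong inj₂ (sym a≡b))
    where
    open ≡-Reasoning
    a≡b : a ≡ b
    a≡b = ¬distinct⇒≡ (begin
      coronaAdj G (inj₁ a) (inj₂ b)                                 ≡⟨ cong₂ (coronaAdj G) e₁ e₂ ⟨
      coronaAdj G (Inverse.to s (inj₁ u)) (Inverse.to s (inj₂ u)) ≡⟨ pres (inj₁ u) (inj₂ u) ⟩
      distinct u u                                                  ≡⟨ distinct-irrefl u ⟩
      false                                                         ∎)

  pairLabeling : ∀ {k} → (Fin (2 + m) → Fin k × Fin k) → Fin ((2 + m) + (2 + m)) → Fin k
  pairLabeling f x = [ proj₁ ∘ f , proj₂ ∘ f ] (splitAt (2 + m) x)

  pairLabeling-distinguishing : ∀ {k} (f : Fin (2 + m) ↣ (Fin k × Fin k)) →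
    IsDistinguishing (corona G) (pairLabeling (Injection.to f))
  pairLabeling-distinguishing f σ aut pres = sumView-fixes⇒fixes σ fixes
    where
    open Injection f using (to; injective)
    s = sumView σ
    label = [ proj₁ ∘ to , proj₂ ∘ to ]

    label-preserved : ∀ a → label (Inverse.to s a) ≡ label a
    label-preserved a = trans (pres (join _ _ a)) (cong label (splitAt-join _ _ a))

    partner-index : ∀ u a → Inverse.to s (inj₁ u) ≡ inj₁ a → Inverse.to s (inj₂ u) ≡ inj₂ a → a ≡ u
    partner-index u a e₁ e₂ = injective (cong₂ _,_
      (trans (cong label (sym e₁)) (label-preserved (inj₁ u)))
      (trans (cong label (sym e₂)) (label-preserved (inj₂ u))))

    fixes : ∀ a → Inverse.to s a ≡ a
    fixes (inj₁ u) with corona-complete-pairs s (sumView-automorphism _ σ aut) u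
    ... | a , e₁ , e₂ = trans e₁ (cong inj₁ (partner-index u a e₁ e₂))
    fixes (inj₂ u) with corona-complete-pairs s (sumView-automorphism _ σ aut) u
    ... | a , e₁ , e₂ = trans e₂ (cong inj₂ (partner-index u a e₁ e₂))

corona-complete-square-distNumber : ∀ q →
  IsDistNumber (corona (complete ((2 + q) * (2 + q)))) (2 + q)
corona-complete-square-distNumber q =
  (pairLabeling _ , pairLabeling-distinguishing (↔⇒↣ *↔×)) ,
  λ r r<k → corona-complete-¬distinguishing (*-mono-< r<k r<k)

theorem3p4 : (p q : ℕ) → 0 < p → 0 < q →
    Σ ℕ λ n → Σ (Graph n) λ G → 1 < n × Connected G ×
      Σ ℕ λ d → Σ ℕ λ d' → IsDistNumber G d × IsDistNumber (corona G) d' × d' * q < p * d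
theorem3p4 (suc p) (suc q) _ _ =
  k * k , complete (k * k) , s≤s (s≤s z≤n) , complete-connected (k * k) ,
  k * k , k , complete-distNumber (k * k) , corona-complete-square-distNumber q ,
  <-≤-trans (*-monoʳ-< k (n<1+n (suc q))) (m≤n*m (k * k) (suc p))
  where k = 2 + q
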